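{- Let $K$ and $\overline{K}$ be two arcs in $PG(2,q)$ with $\overline{K}\subsetneq K$, both hyperfocused on the same line $l$. Then $|K|\geq 2|\overline{K}|$.
   Context: $PG(2,q)$ denotes the Desarguesian projective plane over the finite field $\mathbb{F}_q$. A $k$-arc is a set of $k$ points of the plane, no three of which are collinear; a secant (chord) of an arc is a line containing two of its points. A $k$-arc $K$ is hyperfocused on a line $l$ exterior to $K$ (i.e. $l\cap K=\emptyset$) if the secants of $K$ meet $l$ in a set of exactly $k-1$ points. -}

module Defs where

open import Level using (0ℓ)
open import Algebra.Bundles using (CommutativeRing)
open import Data.Nat using (ℕ; _∸_)
open import Data.Fin using (Fin)
open import Data.Product using (_×_; ∃; Σ)
open import Relation.Nullary using (¬_)
open import Relation.Binary using (Decidable)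
open import Relation.Binary.PropositionalEquality using (_≡_; _≢_)

record FiniteField : Set₁ where
  field
    commRing : CommutativeRing 0ℓ 0ℓ
  open CommutativeRing commRing public hiding (ring)
  field
    _≟_       : Decidable _≈_
    1≉0       : ¬ (1# ≈ 0#)
    inverse   : ∀ x → ¬ (x ≈ 0#) → ∃ λ y → (x * y) ≈ 1#
    q         : ℕ
    enum      : Fin q → Carrier
    enum-inj  : ∀ i j → enum i ≈ enum j → i ≡ j
    enum-surj : ∀ x → ∃ λ i → enum i ≈ x

module PG (F : FiniteField) where
  open FiniteField F

  -- Homogeneous coordinates: a nonzero triple.  Points and lines of PG(2,q)
  -- are both given by nonzero triples, taken up to nonzero scalar multiples.
  record Triple : Set where
    constructor ⟨_,_,_⟩
    field
      c₀ c₁ c₂ : Carrier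
  open Triple public

  NonZero3 : Triple → Set
  NonZero3 t = ¬ ((c₀ t ≈ 0#) × (c₁ t ≈ 0#) × (c₂ t ≈ 0#))

  record Point : Set where
    field
      coords  : Triple
      nonzero : NonZero3 coords
  open Point public

  record Line : Set where
    field
      lcoords  : Triple
      lnonzero : NonZero3 lcoords
  open Line public

  _∼_ : Point → Point → Set
  P ∼ Q = ∃ λ c → ¬ (c ≈ 0#) ×
            (c₀ (coords P) ≈ c * c₀ (coords Q)) ×
            (c₁ (coords P) ≈ c * c₁ (coords Q)) ×
            (c₂ (coords P) ≈ c * c₂ (coords Q))

  _∈L_ : Point → Line → Set
  P ∈L l = ((c₀ (lcoords l) * c₀ (coords P)) +
            (c₁ (lcoords l) * c₁ (coords P)) +
            (c₂ (lcoords l) * c₂ (coords P))) ≈ 0#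

  Collinear : Point → Point → Point → Set
  Collinear P Q R = ∃ λ (m : Line) → (P ∈L m) × (Q ∈L m) × (R ∈L m)

  IsArc : ∀ {k} → (Fin k → Point) → Set
  IsArc {k} K =
    (∀ i j → i ≢ j → ¬ (K i ∼ K j)) ×
    (∀ i j h → i ≢ j → j ≢ h → i ≢ h → ¬ Collinear (K i) (K j) (K h))

  SecantPointOn : ∀ {k} → (Fin k → Point) → Line → Point → Set
  SecantPointOn K l R = (R ∈L l) × ∃ λ i → ∃ λ j → (i ≢ j) × Collinear (K i) (K j) R

  -- K (a k-arc) is hyperfocused on l: l is exterior to K and the secants of K
  -- meet l in a set of exactly k-1 points, i.e. the set of such points is
  -- {S t | t : Fin (k-1)} with the S t pairwise distinct.
  Hyperfocused : ∀ {k} → (Fin k → Point) → Line → Set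
  Hyperfocused {k} K l =
    (∀ i → ¬ (K i ∈L l)) ×
    Σ (Fin (k ∸ 1) → Point) λ S →
      (∀ s t → s ≢ t → ¬ (S s ∼ S t)) ×
      (∀ R → (SecantPointOn K l R → ∃ λ t → R ∼ S t) ×
             ((∃ λ t → R ∼ S t) → SecantPointOn K l R))

-- Let Q be a point of K outside K̄, and m = |K̄|. The secants of K through Q and the points of K̄ meet l
-- in m distinct points T i (two of them coinciding would put three points of K on a line), and the m − 1
-- points of the focus of K̄ are secant points of K as well. No T i is in the focus of K̄: the m − 1 chords
-- of K̄ through K̄ i meet l in m − 1 distinct points, hence in the whole focus, so T i would lie on some chord
-- K̄ i K̄ j and Q, K̄ i, K̄ j would be collinear. So K has at least 2m − 1 secant points on l, i.e. |K| ≥ 2m.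

module Submission where

open import Level using (0ℓ)
open import Algebra.Bundles using (CommutativeRing)
open import Data.Nat as ℕ using (ℕ; zero; suc; _≤_; z≤n; s≤s; _∸_)
import Data.Nat.Properties as ℕₚ
open import Data.Integer as ℤ using (ℤ; +_; -[1+_]; sign; ∣_∣; _◃_; _⊖_)
import Data.Integer.Properties as ℤ
open import Data.Sign as Sign using (Sign)
open import Data.Fin as Fin using (Fin; punchIn; punchOut; splitAt; join)
open import Data.Fin.Properties
  using (any?; injective⇒≤; punchOut-injective; punchIn-injective; punchInᵢ≢i; join-splitAt)
open import Data.Maybe using (Maybe; just; nothing)
open import Data.Product using (∃; Σ; _×_; _,_; proj₁; proj₂)
open import Data.Sum using (_⊎_; inj₁; inj₂)
open import Data.Empty using (⊥-elim)
open import Function using (Injective; _∘_)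
open import Relation.Nullary using (¬_; yes; no)
open import Relation.Nullary.Decidable using (decidable-stable)
open import Relation.Binary.Bundles using (Setoid)
open import Relation.Binary.PropositionalEquality as ≡ using (_≡_; _≢_)

open import Defs

injective⇒surjective : ∀ {n} {f : Fin n → Fin n} → Injective _≡_ _≡_ f → ∀ t → ∃ λ x → f x ≡ t
injective⇒surjective {suc n} {f} f-inj t with any? (λ x → f x Fin.≟ t)
... | yes hit = hit
... | no miss = ⊥-elim (ℕₚ.1+n≰n (injective⇒≤ punchOut-f-injective))
  where
  f≢t : ∀ x → t ≢ f x
  f≢t x t≡fx = miss (x , ≡.sym t≡fx)
  punchOut-f-injective : Injective _≡_ _≡_ (λ x → punchOut (f≢t x))
  punchOut-f-injective {x} {y} eq = f-inj (punchOut-injective (f≢t x) (f≢t y) eq)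

splitAt-injective : ∀ m {n} → Injective _≡_ _≡_ (splitAt m {n})
splitAt-injective m {n} {x} {y} same = begin
  x                          ≡⟨ join-splitAt m n x ⟨
  join m n (splitAt m x)     ≡⟨ ≡.cong (join m n) same ⟩
  join m n (splitAt m y)     ≡⟨ join-splitAt m n y ⟩
  y                          ∎
  where open ≡.≡-Reasoning

m+[m∸1]≤k∸1⇒2*m≤k : ∀ {k} m → Fin k → m ℕ.+ (m ∸ 1) ≤ k ∸ 1 → 2 ℕ.* m ≤ k
m+[m∸1]≤k∸1⇒2*m≤k zero           _ _ = z≤n
m+[m∸1]≤k∸1⇒2*m≤k {suc k} (suc m) _ h rewrite ℕₚ.+-identityʳ m | ℕₚ.+-suc m m = s≤s h

-- The ring solver needs coefficients whose equality it can decide by computation; the elements of an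
-- abstract field are not such, so identities are proved with integer coefficients mapped into the ring.
module IntegerCoefficientSolver {c ℓ} (R : CommutativeRing c ℓ) where
  open CommutativeRing R
  open import Algebra.Properties.Ring ring
  open import Algebra.Properties.Semiring.Mult semiring using (×-homo-+; ×1-homo-*)
    renaming (_×_ to _×ₙ_)
  open import Algebra.Solver.Ring.AlmostCommutativeRing
    using (AlmostCommutativeRing; fromCommutativeRing; _-Raw-AlmostCommutative⟶_)
  open import Relation.Binary.Reasoning.Setoid setoid

  signed : Sign → Carrier → Carrier
  signed Sign.+ x = x
  signed Sign.- x = - x

  ⟦_⟧ℤ : ℤ → Carrier
  ⟦ i ⟧ℤ = signed (sign i) (∣ i ∣ ×ₙ 1#)

  signed-cong : ∀ s {x y} → x ≈ y → signed s x ≈ signed s y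
  signed-cong Sign.+ x≈y = x≈y
  signed-cong Sign.- x≈y = -‿cong x≈y

  signed-* : ∀ s t x y → signed (s Sign.* t) (x * y) ≈ signed s x * signed t y
  signed-* Sign.+ Sign.+ x y = refl
  signed-* Sign.+ Sign.- x y = -‿distribʳ-* x y
  signed-* Sign.- Sign.+ x y = -‿distribˡ-* x y
  signed-* Sign.- Sign.- x y = begin
    x * y             ≈⟨ -‿involutive (x * y) ⟨
    - - (x * y)       ≈⟨ -‿cong (-‿distribˡ-* x y) ⟩
    - (- x * y)       ≈⟨ -‿distribʳ-* (- x) y ⟩
    - x * - y         ∎

  ⟦◃⟧ : ∀ s n → ⟦ s ◃ n ⟧ℤ ≈ signed s (n ×ₙ 1#)
  ⟦◃⟧ Sign.- zero    = sym -0#≈0#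
  ⟦◃⟧ Sign.+ zero    = refl
  ⟦◃⟧ Sign.- (suc n) = refl
  ⟦◃⟧ Sign.+ (suc n) = refl

  ⟦⊖⟧ : ∀ m n → ⟦ m ⊖ n ⟧ℤ ≈ m ×ₙ 1# - n ×ₙ 1#
  ⟦⊖⟧ m       zero    = sym (trans (+-congˡ -0#≈0#) (+-identityʳ _))
  ⟦⊖⟧ zero    (suc n) = sym (+-identityˡ _)
  ⟦⊖⟧ (suc m) (suc n) = begin
    ⟦ suc m ⊖ suc n ⟧ℤ        ≡⟨ ≡.cong ⟦_⟧ℤ (ℤ.[1+m]⊖[1+n]≡m⊖n m n) ⟩
    ⟦ m ⊖ n ⟧ℤ                ≈⟨ ⟦⊖⟧ m n ⟩
    a - b                     ≈⟨ +-congˡ 1-[1+b]≈-b ⟨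
    a + (1# - (1# + b))       ≈⟨ +-assoc a 1# (- (1# + b)) ⟨
    (a + 1#) - (1# + b)       ≈⟨ +-congʳ (+-comm a 1#) ⟩
    (1# + a) - (1# + b)       ∎
    where
    a = m ×ₙ 1#
    b = n ×ₙ 1#
    1-[1+b]≈-b : 1# - (1# + b) ≈ - b
    1-[1+b]≈-b = begin
      1# - (1# + b)           ≈⟨ +-congˡ (-‿+-comm 1# b) ⟨
      1# + (- 1# + - b)       ≈⟨ +-assoc 1# (- 1#) (- b) ⟨
      (1# - 1#) + - b         ≈⟨ +-congʳ (-‿inverseʳ 1#) ⟩
      0# + - b                ≈⟨ +-identityˡ (- b) ⟩
      - b                     ∎

  +-homo : ∀ i j → ⟦ i ℤ.+ j ⟧ℤ ≈ ⟦ i ⟧ℤ + ⟦ j ⟧ℤ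
  +-homo -[1+ m ] -[1+ n ] = begin
    - (suc (suc (m ℕ.+ n)) ×ₙ 1#)          ≈⟨ -‿cong (+-congˡ (×-homo-+ 1# (suc m) n)) ⟩
    - (1# + (suc m ×ₙ 1# + n ×ₙ 1#))        ≈⟨ -‿cong (x+[y+z]≈y+[x+z] 1# (suc m ×ₙ 1#) (n ×ₙ 1#)) ⟩
    - (suc m ×ₙ 1# + suc n ×ₙ 1#)           ≈⟨ -‿+-comm (suc m ×ₙ 1#) (suc n ×ₙ 1#) ⟨
    - (suc m ×ₙ 1#) + - (suc n ×ₙ 1#)       ∎
    where
    x+[y+z]≈y+[x+z] : ∀ x y z → x + (y + z) ≈ y + (x + z)
    x+[y+z]≈y+[x+z] x y z = begin
      x + (y + z)   ≈⟨ +-assoc x y z ⟨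
      (x + y) + z   ≈⟨ +-congʳ (+-comm x y) ⟩
      (y + x) + z   ≈⟨ +-assoc y x z ⟩
      y + (x + z)   ∎
  +-homo -[1+ m ] (+ n)    = trans (⟦⊖⟧ n (suc m)) (+-comm _ _)
  +-homo (+ m)    -[1+ n ] = ⟦⊖⟧ m (suc n)
  +-homo (+ m)    (+ n)    = ×-homo-+ 1# m n

  *-homo : ∀ i j → ⟦ i ℤ.* j ⟧ℤ ≈ ⟦ i ⟧ℤ * ⟦ j ⟧ℤ
  *-homo i j = begin
    ⟦ (sign i Sign.* sign j) ◃ (∣ i ∣ ℕ.* ∣ j ∣) ⟧ℤ
      ≈⟨ ⟦◃⟧ (sign i Sign.* sign j) (∣ i ∣ ℕ.* ∣ j ∣) ⟩
    signed (sign i Sign.* sign j) ((∣ i ∣ ℕ.* ∣ j ∣) ×ₙ 1#)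
      ≈⟨ signed-cong (sign i Sign.* sign j) (×1-homo-* ∣ i ∣ ∣ j ∣) ⟩
    signed (sign i Sign.* sign j) ((∣ i ∣ ×ₙ 1#) * (∣ j ∣ ×ₙ 1#))
      ≈⟨ signed-* (sign i) (sign j) (∣ i ∣ ×ₙ 1#) (∣ j ∣ ×ₙ 1#) ⟩
    ⟦ i ⟧ℤ * ⟦ j ⟧ℤ                                     ∎

  -‿homo : ∀ i → ⟦ ℤ.- i ⟧ℤ ≈ - ⟦ i ⟧ℤ
  -‿homo -[1+ n ]    = sym (-‿involutive _)
  -‿homo (+ zero)    = sym -0#≈0#
  -‿homo (+ suc n)   = refl

  ring⇒almost : AlmostCommutativeRing c ℓ
  ring⇒almost = fromCommutativeRing R

  ℤ⟶R : ℤ.+-*-rawRing -Raw-AlmostCommutative⟶ ring⇒almost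
  ℤ⟶R = record
    { ⟦_⟧ = ⟦_⟧ℤ ; +-homo = +-homo ; *-homo = *-homo ; -‿homo = -‿homo
    ; 0-homo = refl ; 1-homo = +-identityʳ 1# }

  ≟ℤ-weakly : ∀ i j → Maybe (⟦ i ⟧ℤ ≈ ⟦ j ⟧ℤ)
  ≟ℤ-weakly i j with i ℤ.≟ j
  ... | yes ≡.refl = just refl
  ... | no _       = nothing

  open import Algebra.Solver.Ring ℤ.+-*-rawRing ring⇒almost ℤ⟶R ≟ℤ-weakly public
    using (solve; _:=_; _:+_; _:*_; _:-_; con)

module Plane (F : FiniteField) where
  open FiniteField F
  open PG F
  open IntegerCoefficientSolver commRing
  open import Algebra.Properties.AbelianGroup +-abelianGroup using () renaming (x∙y⁻¹≈ε⇒x≈y to x-y≈0⇒x≈y)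
  open import Relation.Binary.Reasoning.Setoid setoid

  inverse⇒nonzero : ∀ {x y} → x * y ≈ 1# → ¬ y ≈ 0#
  inverse⇒nonzero {x} {y} xy≈1 y≈0 = 1≉0 (begin
    1#       ≈⟨ xy≈1 ⟨
    x * y    ≈⟨ *-congˡ y≈0 ⟩
    x * 0#   ≈⟨ zeroʳ x ⟩
    0#       ∎)

  divideˡ : ∀ {x y a b} → x * y ≈ 1# → x * a ≈ b → a ≈ y * b
  divideˡ {x} {y} {a} {b} xy≈1 xa≈b = begin
    a             ≈⟨ *-identityˡ a ⟨
    1# * a        ≈⟨ *-congʳ xy≈1 ⟨
    (x * y) * a   ≈⟨ solve 3 (λ x y a → (x :* y) :* a := y :* (x :* a)) refl x y a ⟩
    y * (x * a)   ≈⟨ *-congˡ xa≈b ⟩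
    y * b         ∎

  nonzero-cancelˡ : ∀ {x a} → ¬ x ≈ 0# → x * a ≈ 0# → a ≈ 0#
  nonzero-cancelˡ {x} x≉0 xa≈0 with inverse x x≉0
  ... | y , xy≈1 = trans (divideˡ xy≈1 xa≈0) (zeroʳ y)

  *-nonzero : ∀ {x y} → ¬ x ≈ 0# → ¬ y ≈ 0# → ¬ x * y ≈ 0#
  *-nonzero x≉0 y≉0 xy≈0 = y≉0 (nonzero-cancelˡ x≉0 xy≈0)

  AllZero : Triple → Set
  AllZero t = (c₀ t ≈ 0#) × (c₁ t ≈ 0#) × (c₂ t ≈ 0#)

  nonzero-coordinate : ∀ t → NonZero3 t → (¬ c₀ t ≈ 0#) ⊎ (¬ c₁ t ≈ 0#) ⊎ (¬ c₂ t ≈ 0#)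
  nonzero-coordinate t t≉0 with c₀ t ≟ 0# | c₁ t ≟ 0# | c₂ t ≟ 0#
  ... | no t₀≉0  | _        | _        = inj₁ t₀≉0
  ... | yes _    | no t₁≉0  | _        = inj₂ (inj₁ t₁≉0)
  ... | yes _    | yes _    | no t₂≉0  = inj₂ (inj₂ t₂≉0)
  ... | yes t₀≈0 | yes t₁≈0 | yes t₂≈0 = ⊥-elim (t≉0 (t₀≈0 , t₁≈0 , t₂≈0))

  -- No hypothesis c ≉ 0 is needed: it follows from P being nonzero.
  ∼-intro : ∀ P Q c → c₀ (coords P) ≈ c * c₀ (coords Q) → c₁ (coords P) ≈ c * c₁ (coords Q) →
            c₂ (coords P) ≈ c * c₂ (coords Q) → P ∼ Q
  ∼-intro P Q c e₀ e₁ e₂ = c , c≉0 , e₀ , e₁ , e₂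
    where
    c≉0 : ¬ c ≈ 0#
    c≉0 c≈0 = nonzero P (vanish e₀ , vanish e₁ , vanish e₂)
      where
      vanish : ∀ {p q} → p ≈ c * q → p ≈ 0#
      vanish {p} {q} p≈cq = trans p≈cq (trans (*-congʳ c≈0) (zeroˡ q))

  ∼-refl : ∀ P → P ∼ P
  ∼-refl P = 1# , 1≉0 , sym (*-identityˡ _) , sym (*-identityˡ _) , sym (*-identityˡ _)

  ∼-sym : ∀ P Q → P ∼ Q → Q ∼ P
  ∼-sym P Q (c , c≉0 , e₀ , e₁ , e₂) with inverse c c≉0
  ... | d , cd≈1 = d , inverse⇒nonzero cd≈1 , flip e₀ , flip e₁ , flip e₂
    where
    flip : ∀ {p q} → p ≈ c * q → q ≈ d * p
    flip p≈cq = divideˡ cd≈1 (sym p≈cq)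

  ∼-trans : ∀ P Q R → P ∼ Q → Q ∼ R → P ∼ R
  ∼-trans P Q R (c , c≉0 , e₀ , e₁ , e₂) (d , d≉0 , f₀ , f₁ , f₂) =
    c * d , *-nonzero c≉0 d≉0 , compose e₀ f₀ , compose e₁ f₁ , compose e₂ f₂
    where
    compose : ∀ {p q r} → p ≈ c * q → q ≈ d * r → p ≈ (c * d) * r
    compose p≈cq q≈dr = trans p≈cq (trans (*-congˡ q≈dr) (sym (*-assoc _ _ _)))

  ∼-setoid : Setoid 0ℓ 0ℓ
  ∼-setoid = record
    { Carrier       = Point
    ; _≈_           = _∼_
    ; isEquivalence = record
        { refl = λ {P} → ∼-refl P ; sym = λ {P Q} → ∼-sym P Q ; trans = λ {P Q R} → ∼-trans P Q R }
    }

  dot : Triple → Triple → Carrier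
  dot ⟨ a , b , c ⟩ ⟨ x , y , z ⟩ = a * x + b * y + c * z

  scale : Carrier → Triple → Triple
  scale c ⟨ x , y , z ⟩ = ⟨ c * x , c * y , c * z ⟩

  dot-scale : ∀ m c t → dot m (scale c t) ≈ c * dot m t
  dot-scale ⟨ a , b , d ⟩ c ⟨ x , y , z ⟩ =
    solve 7 (λ a b d c x y z → a :* (c :* x) :+ b :* (c :* y) :+ d :* (c :* z)
                               := c :* (a :* x :+ b :* y :+ d :* z))
          refl a b d c x y z

  ∈L-resp-∼ : ∀ P Q m → P ∼ Q → Q ∈L m → P ∈L m
  ∈L-resp-∼ P Q m (c , _ , e₀ , e₁ , e₂) Q∈m = begin
    dot (lcoords m) (coords P)            ≈⟨ +-cong (+-cong (*-congˡ e₀) (*-congˡ e₁)) (*-congˡ e₂) ⟩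
    dot (lcoords m) (scale c (coords Q))  ≈⟨ dot-scale (lcoords m) c (coords Q) ⟩
    c * dot (lcoords m) (coords Q)        ≈⟨ *-congˡ Q∈m ⟩
    c * 0#                                ≈⟨ zeroʳ c ⟩
    0#                                    ∎

  cross : Triple → Triple → Triple
  cross ⟨ x₀ , x₁ , x₂ ⟩ ⟨ y₀ , y₁ , y₂ ⟩ = ⟨ x₁ * y₂ - x₂ * y₁ , x₂ * y₀ - x₀ * y₂ , x₀ * y₁ - x₁ * y₀ ⟩

  dot-crossˡ : ∀ x y → dot (cross x y) x ≈ 0#
  dot-crossˡ ⟨ x₀ , x₁ , x₂ ⟩ ⟨ y₀ , y₁ , y₂ ⟩ =
    solve 6 (λ x₀ x₁ x₂ y₀ y₁ y₂ →
               (x₁ :* y₂ :- x₂ :* y₁) :* x₀ :+ (x₂ :* y₀ :- x₀ :* y₂) :* x₁ :+ (x₀ :* y₁ :- x₁ :* y₀) :* x₂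
               := con (+ 0))
          refl x₀ x₁ x₂ y₀ y₁ y₂

  dot-crossʳ : ∀ x y → dot (cross x y) y ≈ 0#
  dot-crossʳ ⟨ x₀ , x₁ , x₂ ⟩ ⟨ y₀ , y₁ , y₂ ⟩ =
    solve 6 (λ x₀ x₁ x₂ y₀ y₁ y₂ →
               (x₁ :* y₂ :- x₂ :* y₁) :* y₀ :+ (x₂ :* y₀ :- x₀ :* y₂) :* y₁ :+ (x₀ :* y₁ :- x₁ :* y₀) :* y₂
               := con (+ 0))
          refl x₀ x₁ x₂ y₀ y₁ y₂

  cross≈0⇒∼-pivot₀ : ∀ P Q → ¬ c₀ (coords Q) ≈ 0# → AllZero (cross (coords P) (coords Q)) → P ∼ Q
  cross≈0⇒∼-pivot₀ P Q q₀≉0 (_ , z₁ , z₂) with inverse (c₀ (coords Q)) q₀≉0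
  ... | w , q₀w≈1 = ∼-intro P Q (p₀ * w)
                      (rescale refl) (rescale (sym (x-y≈0⇒x≈y _ _ z₂))) (rescale (x-y≈0⇒x≈y _ _ z₁))
    where
    p₀ = c₀ (coords P)
    q₀ = c₀ (coords Q)
    rescale : ∀ {p q} → p * q₀ ≈ p₀ * q → p ≈ (p₀ * w) * q
    rescale {p} {q} pq₀≈p₀q = begin
      p                ≈⟨ divideˡ q₀w≈1 (trans (*-comm q₀ p) pq₀≈p₀q) ⟩
      w * (p₀ * q)     ≈⟨ solve 3 (λ w p₀ q → w :* (p₀ :* q) := (p₀ :* w) :* q) refl w p₀ q ⟩
      (p₀ * w) * q     ∎

  rotate : Point → Point
  rotate P = record
    { coords  = ⟨ c₁ (coords P) , c₂ (coords P) , c₀ (coords P) ⟩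
    ; nonzero = λ { (z₁ , z₂ , z₀) → nonzero P (z₀ , z₁ , z₂) }
    }

  ∼-unrotate : ∀ P Q → rotate P ∼ rotate Q → P ∼ Q
  ∼-unrotate P Q (c , c≉0 , e₁ , e₂ , e₀) = c , c≉0 , e₀ , e₁ , e₂

  -- Rotating both points rotates their cross product, so any nonzero coordinate of Q can serve as pivot.
  cross≈0⇒∼ : ∀ P Q → AllZero (cross (coords P) (coords Q)) → P ∼ Q
  cross≈0⇒∼ P Q z@(z₀ , z₁ , z₂) with nonzero-coordinate (coords Q) (nonzero Q)
  ... | inj₁ q₀≉0        = cross≈0⇒∼-pivot₀ P Q q₀≉0 z
  ... | inj₂ (inj₁ q₁≉0) = ∼-unrotate P Q (cross≈0⇒∼-pivot₀ (rotate P) (rotate Q) q₁≉0 (z₁ , z₂ , z₀))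
  ... | inj₂ (inj₂ q₂≉0) = ∼-unrotate P Q (∼-unrotate (rotate P) (rotate Q)
                             (cross≈0⇒∼-pivot₀ (rotate (rotate P)) (rotate (rotate Q)) q₂≉0 (z₂ , z₀ , z₁)))

  line-through : (P Q : Point) → ¬ P ∼ Q → Line
  line-through P Q P≁Q = record
    { lcoords  = cross (coords P) (coords Q)
    ; lnonzero = λ z → P≁Q (cross≈0⇒∼ P Q z)
    }

  ∈-line-throughˡ : ∀ P Q P≁Q → P ∈L line-through P Q P≁Q
  ∈-line-throughˡ P Q _ = dot-crossˡ (coords P) (coords Q)

  ∈-line-throughʳ : ∀ P Q P≁Q → Q ∈L line-through P Q P≁Q
  ∈-line-throughʳ P Q _ = dot-crossʳ (coords P) (coords Q)

  Collinear-resp-∼ : ∀ P P′ Q Q′ R R′ → P ∼ P′ → Q ∼ Q′ → R ∼ R′ → Collinear P′ Q′ R′ → Collinear P Q R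
  Collinear-resp-∼ P P′ Q Q′ R R′ P∼P′ Q∼Q′ R∼R′ (m , P′∈m , Q′∈m , R′∈m) =
    m , ∈L-resp-∼ P P′ m P∼P′ P′∈m , ∈L-resp-∼ Q Q′ m Q∼Q′ Q′∈m , ∈L-resp-∼ R R′ m R∼R′ R′∈m

  arc-¬Collinear : ∀ {k} (K : Fin k → Point) → IsArc K → ∀ {i j h} → i ≢ j → j ≢ h → i ≢ h →
                   ∀ P Q R → P ∼ K i → Q ∼ K j → R ∼ K h → ¬ Collinear P Q R
  arc-¬Collinear K (_ , no-three) {i} {j} {h} i≢j j≢h i≢h P Q R P∼ Q∼ R∼ PQR =
    no-three i j h i≢j j≢h i≢h
      (Collinear-resp-∼ (K i) P (K j) Q (K h) R (∼-sym P (K i) P∼) (∼-sym Q (K j) Q∼) (∼-sym R (K h) R∼) PQR)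

  arc-Collinear⇒≡ : ∀ {k} (K : Fin k → Point) → IsArc K → ∀ {i j h} → i ≢ j → i ≢ h →
                    Collinear (K i) (K j) (K h) → j ≡ h
  arc-Collinear⇒≡ K (_ , no-three) {i} {j} {h} i≢j i≢h ijh =
    decidable-stable (j Fin.≟ h) (λ j≢h → no-three i j h i≢j j≢h i≢h ijh)

  module Meet (l : Line) where

    combine : Carrier → Triple → Carrier → Triple → Triple
    combine a ⟨ x₀ , x₁ , x₂ ⟩ b ⟨ y₀ , y₁ , y₂ ⟩ = ⟨ a * x₀ - b * y₀ , a * x₁ - b * y₁ , a * x₂ - b * y₂ ⟩

    dot-combine : ∀ m a x b y → dot m (combine a x b y) ≈ a * dot m x - b * dot m y
    dot-combine ⟨ m₀ , m₁ , m₂ ⟩ a ⟨ x₀ , x₁ , x₂ ⟩ b ⟨ y₀ , y₁ , y₂ ⟩ =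
      solve 11 (λ m₀ m₁ m₂ a x₀ x₁ x₂ b y₀ y₁ y₂ →
                  m₀ :* (a :* x₀ :- b :* y₀) :+ m₁ :* (a :* x₁ :- b :* y₁) :+ m₂ :* (a :* x₂ :- b :* y₂)
                  := a :* (m₀ :* x₀ :+ m₁ :* x₁ :+ m₂ :* x₂) :- b :* (m₀ :* y₀ :+ m₁ :* y₁ :+ m₂ :* y₂))
            refl m₀ m₁ m₂ a x₀ x₁ x₂ b y₀ y₁ y₂

    _·l : Point → Carrier
    P ·l = dot (lcoords l) (coords P)

    meet : (P Q : Point) → ¬ Q ∈L l → ¬ P ∼ Q → Point
    meet P Q Q∉l P≁Q = record { coords = combine (Q ·l) (coords P) (P ·l) (coords Q) ; nonzero = nz }
      where
      nz : NonZero3 (combine (Q ·l) (coords P) (P ·l) (coords Q))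
      nz (z₀ , z₁ , z₂) with inverse (Q ·l) Q∉l
      ... | w , Qw≈1 = P≁Q (∼-intro P Q (w * P ·l) (solved z₀) (solved z₁) (solved z₂))
        where
        solved : ∀ {p q} → Q ·l * p - P ·l * q ≈ 0# → p ≈ (w * P ·l) * q
        solved z = trans (divideˡ Qw≈1 (x-y≈0⇒x≈y _ _ z)) (sym (*-assoc _ _ _))

    meet-∈l : ∀ P Q Q∉l P≁Q → meet P Q Q∉l P≁Q ∈L l
    meet-∈l P Q _ _ = begin
      dot (lcoords l) (combine (Q ·l) (coords P) (P ·l) (coords Q))
        ≈⟨ dot-combine (lcoords l) (Q ·l) (coords P) (P ·l) (coords Q) ⟩
      Q ·l * P ·l - P ·l * Q ·l
        ≈⟨ solve 2 (λ a b → a :* b :- b :* a := con (+ 0)) refl (Q ·l) (P ·l) ⟩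
      0# ∎

    module _ (P Q : Point) (Q∉l : ¬ Q ∈L l) (P≁Q : ¬ P ∼ Q) (m : Line) where
      private
        u = dot (lcoords m) (coords P)
        v = dot (lcoords m) (coords Q)
        meet·m : dot (lcoords m) (coords (meet P Q Q∉l P≁Q)) ≈ Q ·l * u - P ·l * v
        meet·m = dot-combine (lcoords m) (Q ·l) (coords P) (P ·l) (coords Q)

      meet-∈ : P ∈L m → Q ∈L m → meet P Q Q∉l P≁Q ∈L m
      meet-∈ P∈m Q∈m = begin
        dot (lcoords m) (coords (meet P Q Q∉l P≁Q))   ≈⟨ meet·m ⟩
        Q ·l * u - P ·l * v                           ≈⟨ +-cong (*-congˡ P∈m) (-‿cong (*-congˡ Q∈m)) ⟩
        Q ·l * 0# - P ·l * 0#
          ≈⟨ solve 2 (λ a b → a :* con (+ 0) :- b :* con (+ 0) := con (+ 0)) refl (Q ·l) (P ·l) ⟩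
        0#                                            ∎

      meet-∈⇒∈ʳ : ¬ P ∈L l → P ∈L m → meet P Q Q∉l P≁Q ∈L m → Q ∈L m
      meet-∈⇒∈ʳ P∉l P∈m meet∈m = nonzero-cancelˡ P∉l (begin
        P ·l * v                                  ≈⟨ solve 4 (λ a b u v → b :* v := a :* u :- (a :* u :- b :* v))
                                                           refl (Q ·l) (P ·l) u v ⟩
        Q ·l * u - (Q ·l * u - P ·l * v)          ≈⟨ +-cong (*-congˡ P∈m) (-‿cong (trans (sym meet·m) meet∈m)) ⟩
        Q ·l * 0# - 0#
          ≈⟨ solve 1 (λ a → a :* con (+ 0) :- con (+ 0) := con (+ 0)) refl (Q ·l) ⟩
        0#                                        ∎)

    meet-Collinear : ∀ P Q Q∉l P≁Q → Collinear P Q (meet P Q Q∉l P≁Q)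
    meet-Collinear P Q Q∉l P≁Q = m , P∈m , Q∈m , meet-∈ P Q Q∉l P≁Q m P∈m Q∈m
      where
      m = line-through P Q P≁Q
      P∈m = ∈-line-throughˡ P Q P≁Q
      Q∈m = ∈-line-throughʳ P Q P≁Q

    meet-comm : ∀ P Q P∉l Q∉l P≁Q Q≁P → meet P Q Q∉l P≁Q ∼ meet Q P P∉l Q≁P
    meet-comm P Q P∉l Q∉l P≁Q Q≁P = ∼-intro (meet P Q Q∉l P≁Q) (meet Q P P∉l Q≁P) ⟦ ℤ.-1ℤ ⟧ℤ
      (negate (c₀ (coords P)) (c₀ (coords Q)))
      (negate (c₁ (coords P)) (c₁ (coords Q)))
      (negate (c₂ (coords P)) (c₂ (coords Q)))
      where
      negate : ∀ x y → Q ·l * x - P ·l * y ≈ ⟦ ℤ.-1ℤ ⟧ℤ * (P ·l * y - Q ·l * x)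
      negate = solve 4 (λ a b x y → a :* x :- b :* y := con ℤ.-1ℤ :* (b :* y :- a :* x)) refl (Q ·l) (P ·l)

    meet-∼⇒Collinear : ∀ P Q R P∉l Q∉l R∉l P≁Q P≁R →
                       meet P Q Q∉l P≁Q ∼ meet P R R∉l P≁R → Collinear P Q R
    meet-∼⇒Collinear P Q R P∉l Q∉l R∉l P≁Q P≁R meets∼ = m , P∈m , Q∈m ,
      meet-∈⇒∈ʳ P R R∉l P≁R m P∉l P∈m
        (∈L-resp-∼ (meet P R R∉l P≁R) (meet P Q Q∉l P≁Q) m
          (∼-sym (meet P Q Q∉l P≁Q) (meet P R R∉l P≁R) meets∼) (meet-∈ P Q Q∉l P≁Q m P∈m Q∈m))
      where
      m = line-through P Q P≁Q
      P∈m = ∈-line-throughˡ P Q P≁Q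
      Q∈m = ∈-line-throughʳ P Q P≁Q

  module Focus (l : Line) {n} (A : Fin n → Point) (hf : Hyperfocused A l) where
    open Meet l

    exterior : ∀ i → ¬ A i ∈L l
    exterior = proj₁ hf

    focus : Fin (n ∸ 1) → Point
    focus = proj₁ (proj₂ hf)

    focus-distinct : ∀ s t → s ≢ t → ¬ focus s ∼ focus t
    focus-distinct = proj₁ (proj₂ (proj₂ hf))

    private
      characterisation : ∀ R → (SecantPointOn A l R → ∃ λ t → R ∼ focus t) ×
                               ((∃ λ t → R ∼ focus t) → SecantPointOn A l R)
      characterisation = proj₂ (proj₂ (proj₂ hf))

    focus-secant : ∀ t → SecantPointOn A l (focus t)
    focus-secant t = proj₂ (characterisation (focus t)) (t , ∼-refl (focus t))

    focus-index : ∀ R → SecantPointOn A l R → Fin (n ∸ 1)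
    focus-index R R-sec = proj₁ (proj₁ (characterisation R) R-sec)

    ∼-focus-index : ∀ R R-sec → R ∼ focus (focus-index R R-sec)
    ∼-focus-index R R-sec = proj₂ (proj₁ (characterisation R) R-sec)

    focus-index-injective : ∀ R R′ R-sec R′-sec → focus-index R R-sec ≡ focus-index R′ R′-sec → R ∼ R′
    focus-index-injective R R′ R-sec R′-sec same = ∼-trans R (focus (focus-index R′ R′-sec)) R′
      (≡.subst (λ t → R ∼ focus t) same (∼-focus-index R R-sec))
      (∼-sym R′ (focus (focus-index R′ R′-sec)) (∼-focus-index R′ R′-sec))

    secant-points-≤ : ∀ {p} (P : Fin p → Point) → (∀ x → SecantPointOn A l (P x)) →
                      (∀ x y → P x ∼ P y → x ≡ y) → p ≤ n ∸ 1
    secant-points-≤ P P-sec P-inj = injective⇒≤ {f = λ x → focus-index (P x) (P-sec x)}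
      λ {x} {y} same → P-inj x y (focus-index-injective (P x) (P y) (P-sec x) (P-sec y) same)

    module _ (arc : IsArc A) where

      chord-meet : ∀ a b → a ≢ b → Point
      chord-meet a b a≢b = meet (A a) (A b) (exterior b) (proj₁ arc a b a≢b)

      chord-meet-secant : ∀ a b a≢b → SecantPointOn A l (chord-meet a b a≢b)
      chord-meet-secant a b a≢b = meet-∈l (A a) (A b) (exterior b) (proj₁ arc a b a≢b) , a , b , a≢b
                                , meet-Collinear (A a) (A b) (exterior b) (proj₁ arc a b a≢b)

  -- The n − 1 chords through A a meet l in n − 1 distinct points, hence in every point of the focus.
  focus-on-chords-through : ∀ l {n} (A : Fin n → Point) (hf : Hyperfocused A l) (arc : IsArc A) →
                            let open Focus l A hf in
                            ∀ a (t : Fin (n ∸ 1)) → ∃ λ b → Σ (a ≢ b) λ a≢b → chord-meet arc a b a≢b ∼ focus t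
  focus-on-chords-through l {suc n} A hf arc a t = chord-hitting (injective⇒surjective index-injective t)
    where
    open Focus l A hf
    open Meet l
    a≢ : ∀ b → a ≢ punchIn a b
    a≢ b = punchInᵢ≢i a b ∘ ≡.sym
    index : Fin n → Fin n
    index b = focus-index (chord-meet arc a (punchIn a b) (a≢ b)) (chord-meet-secant arc a (punchIn a b) (a≢ b))
    index-injective : Injective _≡_ _≡_ index
    index-injective {b} {b′} same = punchIn-injective a b b′ (arc-Collinear⇒≡ A arc (a≢ b) (a≢ b′)
      (meet-∼⇒Collinear (A a) (A (punchIn a b)) (A (punchIn a b′))
        (exterior a) (exterior (punchIn a b)) (exterior (punchIn a b′))
        (proj₁ arc a (punchIn a b) (a≢ b)) (proj₁ arc a (punchIn a b′) (a≢ b′))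
        (focus-index-injective _ _ (chord-meet-secant arc a (punchIn a b) (a≢ b))
                                   (chord-meet-secant arc a (punchIn a b′) (a≢ b′)) same)))
    chord-hitting : (∃ λ b → index b ≡ t) → ∃ λ b → Σ (a ≢ b) λ a≢b → chord-meet arc a b a≢b ∼ focus t
    chord-hitting (b , index-b≡t) = punchIn a b , a≢ b ,
      ≡.subst (λ s → chord-meet arc a (punchIn a b) (a≢ b) ∼ focus s) index-b≡t
              (∼-focus-index (chord-meet arc a (punchIn a b) (a≢ b)) (chord-meet-secant arc a (punchIn a b) (a≢ b)))

module HyperfocusedSubarc (F : FiniteField) (l : PG.Line F) {k m : ℕ}
  (K : Fin k → PG.Point F) (K̄ : Fin m → PG.Point F)
  (arcK : PG.IsArc F K) (arcK̄ : PG.IsArc F K̄)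
  (K̄⊆K : ∀ i → ∃ λ j → PG._∼_ F (K̄ i) (K j))
  (j₀ : Fin k) (Kj₀∉K̄ : ∀ i → ¬ PG._∼_ F (K̄ i) (K j₀))
  (hK : PG.Hyperfocused F K l) (hK̄ : PG.Hyperfocused F K̄ l) where
  open PG F
  open Plane F
  open Meet l
  module OnK = Focus l K hK
  module OnK̄ = Focus l K̄ hK̄
  open import Relation.Binary.Reasoning.Setoid ∼-setoid

  ι : Fin m → Fin k
  ι i = proj₁ (K̄⊆K i)

  K̄∼Kι : ∀ i → K̄ i ∼ K (ι i)
  K̄∼Kι i = proj₂ (K̄⊆K i)

  ι-distinct : ∀ {i i′} → i ≢ i′ → ι i ≢ ι i′
  ι-distinct {i} {i′} i≢i′ same = proj₁ arcK̄ i i′ i≢i′ (begin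
    K̄ i        ≈⟨ K̄∼Kι i ⟩
    K (ι i)    ≡⟨ ≡.cong K same ⟩
    K (ι i′)   ≈⟨ K̄∼Kι i′ ⟨
    K̄ i′       ∎)

  ι≢j₀ : ∀ i → ι i ≢ j₀
  ι≢j₀ i same = Kj₀∉K̄ i (≡.subst (λ j → K̄ i ∼ K j) same (K̄∼Kι i))

  Q : Point
  Q = K j₀

  Q≁K̄ : ∀ i → ¬ Q ∼ K̄ i
  Q≁K̄ i Q∼K̄i = Kj₀∉K̄ i (∼-sym Q (K̄ i) Q∼K̄i)

  secant-of-K̄⇒secant-of-K : ∀ R → SecantPointOn K̄ l R → SecantPointOn K l R
  secant-of-K̄⇒secant-of-K R (R∈l , i , j , i≢j , K̄iK̄jR) = R∈l , ι i , ι j , ι-distinct i≢j ,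
    Collinear-resp-∼ (K (ι i)) (K̄ i) (K (ι j)) (K̄ j) R R
      (∼-sym (K̄ i) (K (ι i)) (K̄∼Kι i)) (∼-sym (K̄ j) (K (ι j)) (K̄∼Kι j)) (∼-refl R) K̄iK̄jR

  T : Fin m → Point
  T i = meet Q (K̄ i) (OnK̄.exterior i) (Q≁K̄ i)

  T-secant : ∀ i → SecantPointOn K l (T i)
  T-secant i = meet-∈l Q (K̄ i) (OnK̄.exterior i) (Q≁K̄ i) , j₀ , ι i , ι≢j₀ i ∘ ≡.sym ,
    Collinear-resp-∼ Q Q (K (ι i)) (K̄ i) (T i) (T i)
      (∼-refl Q) (∼-sym (K̄ i) (K (ι i)) (K̄∼Kι i)) (∼-refl (T i))
      (meet-Collinear Q (K̄ i) (OnK̄.exterior i) (Q≁K̄ i))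

  T-injective : ∀ i i′ → T i ∼ T i′ → i ≡ i′
  T-injective i i′ Ti∼Ti′ = decidable-stable (i Fin.≟ i′) λ i≢i′ →
    arc-¬Collinear K arcK (ι≢j₀ i ∘ ≡.sym) (ι-distinct i≢i′) (ι≢j₀ i′ ∘ ≡.sym)
      Q (K̄ i) (K̄ i′) (∼-refl Q) (K̄∼Kι i) (K̄∼Kι i′)
      (meet-∼⇒Collinear Q (K̄ i) (K̄ i′) (OnK.exterior j₀) (OnK̄.exterior i) (OnK̄.exterior i′)
         (Q≁K̄ i) (Q≁K̄ i′) Ti∼Ti′)

  T≁focus : ∀ i t → ¬ T i ∼ OnK̄.focus t
  T≁focus i t Ti∼t with focus-on-chords-through l K̄ hK̄ arcK̄ i t
  ... | j , i≢j , chord∼t =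
    arc-¬Collinear K arcK (ι≢j₀ i) (ι≢j₀ j ∘ ≡.sym) (ι-distinct i≢j)
      (K̄ i) Q (K̄ j) (K̄∼Kι i) (∼-refl Q) (K̄∼Kι j)
      (meet-∼⇒Collinear (K̄ i) Q (K̄ j) (OnK̄.exterior i) (OnK.exterior j₀) (OnK̄.exterior j)
         K̄i≁Q (proj₁ arcK̄ i j i≢j) (begin
           meet (K̄ i) Q (OnK.exterior j₀) K̄i≁Q
             ≈⟨ meet-comm (K̄ i) Q (OnK̄.exterior i) (OnK.exterior j₀) K̄i≁Q (Q≁K̄ i) ⟩
           T i                                      ≈⟨ Ti∼t ⟩
           OnK̄.focus t                              ≈⟨ chord∼t ⟨
           OnK̄.chord-meet arcK̄ i j i≢j             ∎))
    where
    K̄i≁Q : ¬ K̄ i ∼ Q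
    K̄i≁Q K̄i∼Q = Q≁K̄ i (∼-sym (K̄ i) Q K̄i∼Q)

  secant-point : Fin m ⊎ Fin (m ∸ 1) → Point
  secant-point (inj₁ i) = T i
  secant-point (inj₂ t) = OnK̄.focus t

  secant-point-secant : ∀ x → SecantPointOn K l (secant-point x)
  secant-point-secant (inj₁ i) = T-secant i
  secant-point-secant (inj₂ t) = secant-of-K̄⇒secant-of-K (OnK̄.focus t) (OnK̄.focus-secant t)

  secant-point-injective : ∀ x y → secant-point x ∼ secant-point y → x ≡ y
  secant-point-injective (inj₁ i) (inj₁ i′) Ti∼Ti′ = ≡.cong inj₁ (T-injective i i′ Ti∼Ti′)
  secant-point-injective (inj₁ i) (inj₂ t)  Ti∼t   = ⊥-elim (T≁focus i t Ti∼t)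
  secant-point-injective (inj₂ t) (inj₁ i)  t∼Ti   = ⊥-elim (T≁focus i t (∼-sym (OnK̄.focus t) (T i) t∼Ti))
  secant-point-injective (inj₂ s) (inj₂ t)  s∼t    =
    ≡.cong inj₂ (decidable-stable (s Fin.≟ t) λ s≢t → OnK̄.focus-distinct s t s≢t s∼t)

  secant-points-count : m ℕ.+ (m ∸ 1) ≤ k ∸ 1
  secant-points-count = OnK.secant-points-≤ (secant-point ∘ splitAt m) (secant-point-secant ∘ splitAt m)
    λ x y same → splitAt-injective m (secant-point-injective (splitAt m x) (splitAt m y) same)

open import Data.Nat using (_*_)

mainTheorem3 : (F : FiniteField) → let open PG F in
    (l : Line) {k m : ℕ} (K : Fin k → Point) (Kb : Fin m → Point) →
    IsArc K → IsArc Kb →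
    (∀ i → ∃ λ j → Kb i ∼ K j) →
    (∃ λ j → ∀ i → ¬ (Kb i ∼ K j)) →
    Hyperfocused K l → Hyperfocused Kb l →
    2 * m ≤ k
mainTheorem3 F l {m = m} K K̄ arcK arcK̄ K̄⊆K (j₀ , Kj₀∉K̄) hK hK̄ =
  m+[m∸1]≤k∸1⇒2*m≤k m j₀
    (HyperfocusedSubarc.secant-points-count F l K K̄ arcK arcK̄ K̄⊆K j₀ Kj₀∉K̄ hK hK̄)
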